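{- Let $k\ge2$ and let $3\le a_1<a_2<\cdots<a_k$ be integers such that either $a_k\le 2a_1-2$ or $a_k\le a_1+\left\lfloor\frac14\left(a_1^2-10a_1^{3/2}\right)\right\rfloor$. Then $(a_1,\dots,a_k)$ is a $k$-flip sequence.
   Context: All graphs are finite and simple. A strictly increasing sequence of positive integers $(a_1,\dots,a_k)$ is a $k$-flip sequence if there is a graph $G$ and an edge-colouring $f:E(G)\to\{1,\dots,k\}$ such that every vertex is incident with exactly $a_j$ edges of colour $j$ for each $j$, and for every vertex $v$, $e_k[v]<\cdots<e_1[v]$, where $e_j[v]$ is the number of colour-$j$ edges with both endpoints in $N[v]=N(v)\cup\{v\}$. -}

module Defs where

open import Data.Nat using (ℕ; zero; suc; _+_; _*_; _∸_; _^_; _≤_; _<_)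
open import Data.Fin using (Fin; zero; suc; toℕ)
open import Data.Bool using (Bool; true; false; if_then_else_; _∨_; _∧_)
open import Data.Maybe using (Maybe; just; nothing; is-just)
open import Data.Product using (Σ; _×_; ∃-syntax)
open import Relation.Binary.PropositionalEquality using (_≡_)
open import Relation.Nullary.Decidable using (⌊_⌋)
import Data.Fin.Properties as FinP
import Data.Nat.Properties as NatP
import Data.Maybe.Properties as MaybeP

sumFin : ∀ {n} → (Fin n → ℕ) → ℕ
sumFin {zero}  f = 0
sumFin {suc n} f = f zero + sumFin (λ i → f (suc i))

count : ∀ {n} → (Fin n → Bool) → ℕ
count {zero}  p = 0
count {suc n} p = (if p zero then 1 else 0) + count (λ i → p (suc i))

-- A finite simple graph on vertex set Fin n together with an edge-colouring
-- with colours Fin k, encoded as one function: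
--   E u v ≡ nothing   : u v is not an edge
--   E u v ≡ just j    : u v is an edge of colour j
-- Simplicity: symmetric and loopless.
record ColouredGraph (n k : ℕ) : Set where
  field
    E     : Fin n → Fin n → Maybe (Fin k)
    sym   : ∀ u v → E u v ≡ E v u
    loopless : ∀ v → E v v ≡ nothing

module _ {n k : ℕ} (G : ColouredGraph n k) where
  open ColouredGraph G

  hasColour : Fin k → Fin n → Fin n → Bool
  hasColour j u v = ⌊ MaybeP.≡-dec FinP._≟_ (E u v) (just j) ⌋

  colourDegree : Fin k → Fin n → ℕ
  colourDegree j v = count (hasColour j v)

  inClosedNbhd : Fin n → Fin n → Bool
  inClosedNbhd v x = ⌊ x FinP.≟ v ⌋ ∨ is-just (E v x)

  e : Fin k → Fin n → ℕ
  e j v = sumFin (λ x → count (λ y →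
            ⌊ toℕ x NatP.<? toℕ y ⌋ ∧ inClosedNbhd v x ∧ inClosedNbhd v y
              ∧ hasColour j x y))

-- A strictly increasing sequence of positive integers (a_1,…,a_k),
-- indexed by Fin k (a zero = a_1), is a k-flip sequence if there is a
-- (nonempty) finite simple graph with a k-edge-colouring such that every
-- vertex has exactly a_j edges of colour j, and e_k[v] < … < e_1[v]
-- (expressed as: i < j ⇒ e_j[v] < e_i[v]) for every vertex v.
IsFlipSequence : (k : ℕ) → (Fin k → ℕ) → Set
IsFlipSequence k a =
  (∀ i → 0 < a i) ×
  (∀ i j → toℕ i < toℕ j → a i < a j) ×
  (∃[ n ] Σ (ColouredGraph (suc n) k) λ G →
     (∀ j v → colourDegree G j v ≡ a j) ×
     (∀ v i j → toℕ i < toℕ j → e G j v < e G i v))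

-- With d = a_k − a_1 (an integer) this is d ≤ (a_1² − 10 a_1^{3/2})/4 over
-- the reals, i.e. 4d + 10 a_1^{3/2} ≤ a_1², i.e.
-- 4d ≤ a_1²  and  100 a_1³ ≤ (a_1² − 4d)².
FloorCondition : ℕ → ℕ → Set
FloorCondition a₁ aₖ =
  (4 * (aₖ ∸ a₁) ≤ a₁ ^ 2) × (100 * a₁ ^ 3 ≤ (a₁ ^ 2 ∸ 4 * (aₖ ∸ a₁)) ^ 2)

-- The Cartesian product of edge-coloured graphs, (u , w) ~ (u′ , w′) when u = u′ and w ~ w′ in H or
-- w = w′ and u ~ u′ in G (keeping the colour), adds up the colour degrees and the counts e_j[v].
-- A colour-c clique on p + 1 vertices has colour-c degree p and e_c = C(p+1,2) = p + C(p,2).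
-- So if every a_j is split into parts p with Σ C(p,2) = t_j, the product of the corresponding
-- cliques has colour degrees a_j and e_j[v] = a_j + t_j at every vertex, and it remains to choose
-- the t_j so that a_j + t_j decreases in j.  If a_k ≤ 2a_1 − 2, take t_j = C(a_k − a_j + 2, 2),
-- realised by the single part a_k − a_j + 2 ≤ a_j padded with parts 1.  Otherwise take
-- t_j = 2(a_k − a_j), written greedily as C(p,2) + C(q,2) + r·C(2,2); the floor condition
-- makes these parts fit into a_1.
module Submission where

open import Defs
open import Algebra.Bundles using (CommutativeMonoid)
open import Data.Bool using (Bool; true; false; _∧_; _∨_; not; if_then_else_)
open import Data.Bool.Properties using (∧-zeroʳ; ∧-commutativeMonoid)
open import Data.Fin using (Fin; zero; suc; toℕ; fromℕ; _↑ˡ_; _↑ʳ_; combine; remQuot; punchIn)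
open import Data.Fin.Properties
  using (_≟_; ≤fromℕ; punchInᵢ≢i; toℕ-injective; remQuot-combine; combine-remQuot; combine-injectiveˡ; combine-injectiveʳ)
open import Data.List using (List; []; _∷_; _++_; map)
open import Data.List.Properties using (map-++)
open import Data.Maybe using (Maybe; just; nothing; is-just)
open import Data.Maybe.Properties using (≡-dec)
open import Data.Nat using (ℕ; zero; suc; _+_; _*_; _∸_; _^_; _≤_; _<_; z≤n; s≤s; z<s; _<?_; >-nonZero)
open import Data.Nat.Properties hiding (_≟_)
import Data.Nat.ListAction as List
open import Data.Nat.ListAction.Properties using (sum-++)
open import Data.Nat.Tactic.RingSolver using (solve-∀; solve)
open import Data.Product using (_×_; _,_; proj₁; proj₂; ∃-syntax)
open import Data.Sum using (_⊎_; inj₁; inj₂)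
open import Function using (_∘_; _∘′_)
open import Relation.Binary.PropositionalEquality
open import Relation.Nullary using (Dec; yes; no; contradiction)
open import Relation.Nullary.Decidable using (⌊_⌋; isYes≗does; ⌊⌋-map′; dec-true; dec-false)
open import Algebra.Properties.CommutativeMonoid.Sum +-0-commutativeMonoid
  using (sum; sum-syntax; sum-cong-≗; ∑-distrib-+; ∑-comm; sum-replicate-zero; sum-remove)
open import Algebra.Properties.CommutativeSemigroup (CommutativeMonoid.commutativeSemigroup ∧-commutativeMonoid)
  using (x∙yz≈y∙xz)
open import Algebra.Properties.CommutativeSemigroup +-commutativeSemigroup
  using () renaming (interchange to +-interchange)

-- Indicators and finite sums

infix 8 _≐_
_≐_ : ∀ {n} → Fin n → Fin n → Bool
x ≐ y = ⌊ x ≟ y ⌋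

≐-refl : ∀ {n} (x : Fin n) → (x ≐ x) ≡ true
≐-refl x = trans (isYes≗does (x ≟ x)) (dec-true (x ≟ x) refl)

≐-false : ∀ {n} {x y : Fin n} → x ≢ y → (x ≐ y) ≡ false
≐-false {x = x} {y} x≢y = trans (isYes≗does (x ≟ y)) (dec-false (x ≟ y) x≢y)

≐-sym : ∀ {n} (x y : Fin n) → (x ≐ y) ≡ (y ≐ x)
≐-sym x y with x ≟ y
... | yes refl = sym (≐-refl x)
... | no x≢y   = sym (≐-false (x≢y ∘ sym))

combine-≐ : ∀ {m n} (u₁ : Fin m) (w₁ : Fin n) u w → (combine u₁ w₁ ≐ combine u w) ≡ (u₁ ≐ u ∧ w₁ ≐ w)
combine-≐ u₁ w₁ u w with u₁ ≟ u | w₁ ≟ w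
... | yes refl | yes refl = ≐-refl _
... | yes refl | no w₁≢w  = ≐-false (w₁≢w ∘ combine-injectiveʳ u₁ w₁ u₁ w)
... | no u₁≢u  | _        = ≐-false (u₁≢u ∘ combine-injectiveˡ u₁ w₁ u w)

infixr 7 _·_
_·_ : Bool → ℕ → ℕ
b · x = if b then x else 0

𝟙 : Bool → ℕ
𝟙 b = b · 1

𝟙-∧ : ∀ a b c → 𝟙 (a ∧ b ∧ c) ≡ a · b · 𝟙 c
𝟙-∧ true  true  c = refl
𝟙-∧ true  false c = refl
𝟙-∧ false b     c = refl

·-zeroʳ : ∀ b → b · 0 ≡ 0
·-zeroʳ true  = refl
·-zeroʳ false = refl

·-·-zeroʳ : ∀ a b → a · b · 0 ≡ 0
·-·-zeroʳ a b = trans (cong (a ·_) (·-zeroʳ b)) (·-zeroʳ a)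

·-distribˡ-+ : ∀ b x y → b · (x + y) ≡ b · x + b · y
·-distribˡ-+ true  x y = refl
·-distribˡ-+ false x y = refl

·-·-distribˡ-+ : ∀ a b x y → a · b · (x + y) ≡ a · b · x + a · b · y
·-·-distribˡ-+ a b x y = trans (cong (a ·_) (·-distribˡ-+ b x y)) (·-distribˡ-+ a (b · x) (b · y))

*-· : ∀ m b x → m * (b · x) ≡ b · (m * x)
*-· m true  x = refl
*-· m false x = *-zeroʳ m

·-≐-≢ : ∀ {n} {x x₁ x₂ : Fin n} m → x₁ ≢ x₂ → (x ≐ x₁) · (x ≐ x₂) · m ≡ 0
·-≐-≢ {x = x} {x₁} m x₁≢x₂ with x ≟ x₁
... | yes refl = cong (_· m) (≐-false x₁≢x₂)
... | no _     = refl

sumFin≡sum : ∀ {n} (f : Fin n → ℕ) → sumFin f ≡ sum f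
sumFin≡sum {zero}  f = refl
sumFin≡sum {suc n} f = cong (f zero +_) (sumFin≡sum (f ∘ suc))

count≡∑𝟙 : ∀ {n} (p : Fin n → Bool) → count p ≡ sum (𝟙 ∘ p)
count≡∑𝟙 {zero}  p = refl
count≡∑𝟙 {suc n} p = cong (𝟙 (p zero) +_) (count≡∑𝟙 (p ∘ suc))

∑-const : ∀ n c → ∑[ i < n ] c ≡ n * c
∑-const zero    c = refl
∑-const (suc n) c = cong (c +_) (∑-const n c)

∑-· : ∀ {n} b (f : Fin n → ℕ) → ∑[ i < n ] (b · f i) ≡ b · sum f
∑-·     true  f = refl
∑-· {n} false f = sum-replicate-zero n

∑-δˡ : ∀ {n} (c : Fin n) (f : Fin n → ℕ) → ∑[ i < n ] ((c ≐ i) · f i) ≡ f c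
∑-δˡ {suc n} zero    f = trans (cong (f zero +_) (sum-replicate-zero n)) (+-identityʳ (f zero))
∑-δˡ {suc n} (suc c) f =
  trans (sum-cong-≗ (λ i → cong (_· f (suc i)) (⌊⌋-map′ _ _ (c ≟ i)))) (∑-δˡ c (f ∘ suc))

∑-δʳ : ∀ {n} (c : Fin n) (f : Fin n → ℕ) → ∑[ i < n ] ((i ≐ c) · f i) ≡ f c
∑-δʳ c f = trans (sum-cong-≗ (λ i → cong (_· f i) (≐-sym i c))) (∑-δˡ c f)

∑𝟙-≢ : ∀ {n} (v : Fin (suc n)) → ∑[ y < suc n ] 𝟙 (not (v ≐ y)) ≡ n
∑𝟙-≢ {n} v = begin
  sum t                             ≡⟨ sum-remove {i = v} t ⟩
  t v + ∑[ y < n ] t (punchIn v y)  ≡⟨ cong₂ _+_ (cong (𝟙 ∘ not) (≐-refl v)) (sum-cong-≗ t∘punchIn≡1) ⟩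
  ∑[ y < n ] 1                      ≡⟨ ∑-const n 1 ⟩
  n * 1                             ≡⟨ *-identityʳ n ⟩
  n                                 ∎
  where
  open ≡-Reasoning
  t : Fin (suc n) → ℕ
  t y = 𝟙 (not (v ≐ y))
  t∘punchIn≡1 : ∀ y → t (punchIn v y) ≡ 1
  t∘punchIn≡1 y = cong (𝟙 ∘ not) (≐-false (punchInᵢ≢i v y ∘ sym))

∑-↑ : ∀ m {n} (f : Fin (m + n) → ℕ) → sum f ≡ ∑[ i < m ] f (i ↑ˡ n) + ∑[ j < n ] f (m ↑ʳ j)
∑-↑ zero    f = refl
∑-↑ (suc m) f = trans (cong (f zero +_) (∑-↑ m (f ∘ suc))) (sym (+-assoc (f zero) _ _))

∑-combine : ∀ {m n} (f : Fin (m * n) → ℕ) → sum f ≡ ∑[ i < m ] ∑[ j < n ] f (combine i j)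
∑-combine {zero}      f = refl
∑-combine {suc m} {n} f =
  trans (∑-↑ n f) (cong (∑[ j < n ] f (j ↑ˡ (m * n)) +_) (∑-combine {m} {n} (f ∘ (n ↑ʳ_))))

module _ {m n : ℕ} where

  ∑⁴-distrib-+ : (f g : Fin m → Fin n → Fin m → Fin n → ℕ) →
    ∑[ u₁ < m ] ∑[ w₁ < n ] ∑[ u₂ < m ] ∑[ w₂ < n ] (f u₁ w₁ u₂ w₂ + g u₁ w₁ u₂ w₂)
      ≡ ∑[ u₁ < m ] ∑[ w₁ < n ] ∑[ u₂ < m ] ∑[ w₂ < n ] f u₁ w₁ u₂ w₂
        + ∑[ u₁ < m ] ∑[ w₁ < n ] ∑[ u₂ < m ] ∑[ w₂ < n ] g u₁ w₁ u₂ w₂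
  ∑⁴-distrib-+ f g =
    trans (sum-cong-≗ λ u₁ →
      trans (sum-cong-≗ λ w₁ →
        trans (sum-cong-≗ λ u₂ → ∑-distrib-+ (f u₁ w₁ u₂) (g u₁ w₁ u₂))
              (∑-distrib-+ (λ u₂ → sum (f u₁ w₁ u₂)) (λ u₂ → sum (g u₁ w₁ u₂))))
            (∑-distrib-+ (λ w₁ → ∑[ u₂ < m ] sum (f u₁ w₁ u₂)) (λ w₁ → ∑[ u₂ < m ] sum (g u₁ w₁ u₂))))
          (∑-distrib-+ (λ u₁ → ∑[ w₁ < n ] ∑[ u₂ < m ] sum (f u₁ w₁ u₂))
                       (λ u₁ → ∑[ w₁ < n ] ∑[ u₂ < m ] sum (g u₁ w₁ u₂)))

  ∑⁴-fibreˡ : ∀ u (f : Fin n → Fin n → ℕ) →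
    ∑[ u₁ < m ] ∑[ w₁ < n ] ∑[ u₂ < m ] ∑[ w₂ < n ] ((u ≐ u₁) · (u ≐ u₂) · f w₁ w₂)
      ≡ ∑[ w₁ < n ] ∑[ w₂ < n ] f w₁ w₂
  ∑⁴-fibreˡ u f = begin
    ∑[ u₁ < m ] ∑[ w₁ < n ] ∑[ u₂ < m ] ∑[ w₂ < n ] ((u ≐ u₁) · (u ≐ u₂) · f w₁ w₂)
      ≡⟨ sum-cong-≗ (λ u₁ → sum-cong-≗ λ w₁ → sum-cong-≗ λ u₂ →
           trans (∑-· (u ≐ u₁) (λ w₂ → (u ≐ u₂) · f w₁ w₂))
                 (cong ((u ≐ u₁) ·_) (∑-· (u ≐ u₂) (f w₁)))) ⟩
    ∑[ u₁ < m ] ∑[ w₁ < n ] ∑[ u₂ < m ] ((u ≐ u₁) · (u ≐ u₂) · sum (f w₁))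
      ≡⟨ sum-cong-≗ (λ u₁ → sum-cong-≗ λ w₁ →
           trans (∑-· (u ≐ u₁) (λ u₂ → (u ≐ u₂) · sum (f w₁)))
                 (cong ((u ≐ u₁) ·_) (∑-δˡ u (λ _ → sum (f w₁))))) ⟩
    ∑[ u₁ < m ] ∑[ w₁ < n ] ((u ≐ u₁) · sum (f w₁))
      ≡⟨ sum-cong-≗ (λ u₁ → ∑-· (u ≐ u₁) (λ w₁ → sum (f w₁))) ⟩
    ∑[ u₁ < m ] ((u ≐ u₁) · ∑[ w₁ < n ] sum (f w₁))
      ≡⟨ ∑-δˡ u (λ _ → ∑[ w₁ < n ] sum (f w₁)) ⟩
    ∑[ w₁ < n ] ∑[ w₂ < n ] f w₁ w₂
      ∎
    where open ≡-Reasoning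

  ∑⁴-fibreʳ : ∀ w (g : Fin m → Fin m → ℕ) →
    ∑[ u₁ < m ] ∑[ w₁ < n ] ∑[ u₂ < m ] ∑[ w₂ < n ] ((w ≐ w₁) · (w ≐ w₂) · g u₁ u₂)
      ≡ ∑[ u₁ < m ] ∑[ u₂ < m ] g u₁ u₂
  ∑⁴-fibreʳ w g = begin
    ∑[ u₁ < m ] ∑[ w₁ < n ] ∑[ u₂ < m ] ∑[ w₂ < n ] ((w ≐ w₁) · (w ≐ w₂) · g u₁ u₂)
      ≡⟨ sum-cong-≗ (λ u₁ → sum-cong-≗ λ w₁ → sum-cong-≗ λ u₂ →
           trans (∑-· (w ≐ w₁) (λ w₂ → (w ≐ w₂) · g u₁ u₂))
                 (cong ((w ≐ w₁) ·_) (∑-δˡ w (λ _ → g u₁ u₂)))) ⟩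
    ∑[ u₁ < m ] ∑[ w₁ < n ] ∑[ u₂ < m ] ((w ≐ w₁) · g u₁ u₂)
      ≡⟨ sum-cong-≗ (λ u₁ → sum-cong-≗ λ w₁ → ∑-· (w ≐ w₁) (g u₁)) ⟩
    ∑[ u₁ < m ] ∑[ w₁ < n ] ((w ≐ w₁) · sum (g u₁))
      ≡⟨ sum-cong-≗ (λ u₁ → ∑-δˡ w (λ _ → sum (g u₁))) ⟩
    ∑[ u₁ < m ] ∑[ u₂ < m ] g u₁ u₂
      ∎
    where open ≡-Reasoning

infix 8 _<ᶠ_
_<ᶠ_ : ∀ {n} → Fin n → Fin n → Bool
x <ᶠ y = ⌊ toℕ x <? toℕ y ⌋

module _ {n} (q : Fin n → Fin n → Bool) (q-sym : ∀ x y → q x y ≡ q y x) (q-irrefl : ∀ x → q x x ≡ false) where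

  𝟙-split-< : ∀ x y → 𝟙 (q x y) ≡ 𝟙 (x <ᶠ y ∧ q x y) + 𝟙 (y <ᶠ x ∧ q y x)
  𝟙-split-< x y with toℕ x <? toℕ y | toℕ y <? toℕ x
  ... | yes x<y | yes y<x = contradiction x<y (<-asym y<x)
  ... | yes _   | no _    = sym (+-identityʳ _)
  ... | no _    | yes _   = cong 𝟙 (q-sym x y)
  ... | no x≮y  | no y≮x with toℕ-injective (≤-antisym (≮⇒≥ y≮x) (≮⇒≥ x≮y))
  ...   | refl = cong 𝟙 (q-irrefl x)

  ∑∑-symmetric : ∑[ x < n ] ∑[ y < n ] 𝟙 (q x y) ≡ 2 * ∑[ x < n ] ∑[ y < n ] 𝟙 (x <ᶠ y ∧ q x y)
  ∑∑-symmetric = begin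
    ∑[ x < n ] ∑[ y < n ] 𝟙 (q x y)                          ≡⟨ sum-cong-≗ (λ x → sum-cong-≗ (𝟙-split-< x)) ⟩
    ∑[ x < n ] ∑[ y < n ] (upper x y + upper y x)            ≡⟨ sum-cong-≗ (λ x → ∑-distrib-+ (upper x) (λ y → upper y x)) ⟩
    ∑[ x < n ] (∑[ y < n ] upper x y + ∑[ y < n ] upper y x) ≡⟨ ∑-distrib-+ (λ x → ∑[ y < n ] upper x y) _ ⟩
    S + ∑[ x < n ] ∑[ y < n ] upper y x                      ≡⟨ cong (S +_) (∑-comm (λ x y → upper y x)) ⟩
    S + S                                                    ≡⟨ cong (S +_) (+-identityʳ S) ⟨
    2 * S                                                    ∎
    where
    open ≡-Reasoning
    upper : Fin n → Fin n → ℕ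
    upper x y = 𝟙 (x <ᶠ y ∧ q x y)
    S : ℕ
    S = ∑[ x < n ] ∑[ y < n ] upper x y

module _ {n k} (G : ColouredGraph n k) where

  hasColour-sym : ∀ j x y → hasColour G j x y ≡ hasColour G j y x
  hasColour-sym j x y rewrite ColouredGraph.sym G x y = refl

  hasColour-irrefl : ∀ j x → hasColour G j x x ≡ false
  hasColour-irrefl j x rewrite ColouredGraph.loopless G x = refl

  ·-·-𝟙-hasColour-≐ : ∀ j v x y a b → (x ≐ v ∧ a) · (y ≐ v ∧ b) · 𝟙 (hasColour G j x y) ≡ 0
  ·-·-𝟙-hasColour-≐ j v x y a b with x ≟ v | y ≟ v
  ... | yes refl | yes refl rewrite hasColour-irrefl j x = ·-·-zeroʳ a b
  ... | yes refl | no _     = ·-zeroʳ a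
  ... | no _     | _        = refl

  -- Counting ordered pairs avoids the vertex order x < y used by e, which does not
  -- interact with the encoding of product vertices.
  eOrdered : Fin k → Fin n → ℕ
  eOrdered j v = ∑[ x < n ] ∑[ y < n ] 𝟙 (N x ∧ N y ∧ hasColour G j x y)
    where N = inClosedNbhd G v

  eOrdered≡2*e : ∀ j v → eOrdered j v ≡ 2 * e G j v
  eOrdered≡2*e j v = begin
    eOrdered j v
      ≡⟨ ∑∑-symmetric q q-sym q-irrefl ⟩
    2 * ∑[ x < n ] ∑[ y < n ] 𝟙 (x <ᶠ y ∧ q x y)
      ≡⟨ cong (2 *_) (sum-cong-≗ {n} (λ x → count≡∑𝟙 (λ y → x <ᶠ y ∧ q x y))) ⟨
    2 * ∑[ x < n ] count (λ y → x <ᶠ y ∧ q x y)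
      ≡⟨ cong (2 *_) (sumFin≡sum {n} _) ⟨
    2 * e G j v
      ∎
    where
    open ≡-Reasoning
    N = inClosedNbhd G v
    q : Fin n → Fin n → Bool
    q x y = N x ∧ N y ∧ hasColour G j x y
    q-sym : ∀ x y → q x y ≡ q y x
    q-sym x y = trans (x∙yz≈y∙xz (N x) (N y) _) (cong (λ b → N y ∧ N x ∧ b) (hasColour-sym j x y))
    q-irrefl : ∀ x → q x x ≡ false
    q-irrefl x rewrite hasColour-irrefl j x | ∧-zeroʳ (N x) = ∧-zeroʳ (N x)

  e≡-from-eOrdered : ∀ j v {x} → eOrdered j v ≡ 2 * x → e G j v ≡ x
  e≡-from-eOrdered j v h = *-cancelˡ-≡ _ _ 2 (trans (sym (eOrdered≡2*e j v)) h)

-- Uniform graphs and cliques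

record Uniform (k : ℕ) (d ε : Fin k → ℕ) : Set where
  field
    {n}           : ℕ
    graph         : ColouredGraph (suc n) k
    colourDegree≡ : ∀ j v → colourDegree graph j v ≡ d j
    e≡            : ∀ j v → e graph j v ≡ ε j

  eOrdered≡ : ∀ j v → eOrdered graph j v ≡ 2 * ε j
  eOrdered≡ j v = trans (eOrdered≡2*e graph j v) (cong (2 *_) (e≡ j v))

Uniform-cong : ∀ {k} {d d′ ε ε′ : Fin k → ℕ} → d ≗ d′ → ε ≗ ε′ → Uniform k d ε → Uniform k d′ ε′
Uniform-cong d≗d′ ε≗ε′ U = record
  { graph         = graph
  ; colourDegree≡ = λ j v → trans (colourDegree≡ j v) (d≗d′ j)
  ; e≡            = λ j v → trans (e≡ j v) (ε≗ε′ j)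
  }
  where open Uniform U

point : ∀ {k} → Uniform k (λ _ → 0) (λ _ → 0)
point = record
  { n             = 0
  ; graph         = record { E = λ _ _ → nothing ; sym = λ _ _ → refl ; loopless = λ _ → refl }
  ; colourDegree≡ = λ { _ zero → refl }
  ; e≡            = λ { _ zero → refl }
  }

C₂ : ℕ → ℕ
C₂ zero    = 0
C₂ (suc p) = p + C₂ p

2*C₂[1+p]≡[1+p]*p : ∀ p → 2 * C₂ (suc p) ≡ suc p * p
2*C₂[1+p]≡[1+p]*p zero    = refl
2*C₂[1+p]≡[1+p]*p (suc p) = begin
  2 * (suc p + (p + C₂ p))    ≡⟨ *-distribˡ-+ 2 (suc p) (C₂ (suc p)) ⟩
  2 * suc p + 2 * C₂ (suc p)  ≡⟨ cong (2 * suc p +_) (2*C₂[1+p]≡[1+p]*p p) ⟩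
  2 * suc p + suc p * p       ≡⟨ solve (p ∷ []) ⟩
  suc (suc p) * suc p         ∎
  where open ≡-Reasoning

_↦_ : ∀ {k} → Fin k → ℕ → Fin k → ℕ
(c ↦ x) j = (c ≐ j) · x

module _ {k} (c : Fin k) (p : ℕ) where

  completeGraph : ColouredGraph (suc p) k
  completeGraph = record
    { E        = λ x y → if x ≐ y then nothing else just c
    ; sym      = λ x y → cong (if_then nothing else just c) (≐-sym x y)
    ; loopless = λ x → cong (if_then nothing else just c) (≐-refl x)
    }

  private
    K = completeGraph

  𝟙-hasColour-K : ∀ j x y → 𝟙 (hasColour K j x y) ≡ (c ≐ j) · 𝟙 (not (x ≐ y))
  𝟙-hasColour-K j x y with x ≟ y
  ... | yes _ = sym (·-zeroʳ (c ≐ j))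
  ... | no _  = cong 𝟙 (⌊⌋-map′ _ _ (c ≟ j))

  colourDegree-K : ∀ j v → colourDegree K j v ≡ (c ↦ p) j
  colourDegree-K j v = begin
    count (hasColour K j v)                     ≡⟨ count≡∑𝟙 (hasColour K j v) ⟩
    ∑[ y < suc p ] 𝟙 (hasColour K j v y)        ≡⟨ sum-cong-≗ (𝟙-hasColour-K j v) ⟩
    ∑[ y < suc p ] ((c ≐ j) · 𝟙 (not (v ≐ y)))  ≡⟨ ∑-· (c ≐ j) (λ y → 𝟙 (not (v ≐ y))) ⟩
    (c ≐ j) · ∑[ y < suc p ] 𝟙 (not (v ≐ y))    ≡⟨ cong ((c ≐ j) ·_) (∑𝟙-≢ v) ⟩
    (c ≐ j) · p                                 ∎
    where open ≡-Reasoning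

  inClosedNbhd-K : ∀ v x → inClosedNbhd K v x ≡ true
  inClosedNbhd-K v x with x ≟ v
  ... | yes _  = refl
  ... | no x≢v rewrite ≐-false (x≢v ∘ sym) = refl

  eOrdered-K : ∀ j v → eOrdered K j v ≡ 2 * (c ↦ C₂ (suc p)) j
  eOrdered-K j v = begin
    eOrdered K j v
      ≡⟨ sum-cong-≗ (λ x → sum-cong-≗ λ y →
           cong₂ (λ a b → 𝟙 (a ∧ b ∧ hasColour K j x y)) (inClosedNbhd-K v x) (inClosedNbhd-K v y)) ⟩
    ∑[ x < suc p ] ∑[ y < suc p ] 𝟙 (hasColour K j x y)
      ≡⟨ sum-cong-≗ (λ x → trans (sym (count≡∑𝟙 (hasColour K j x))) (colourDegree-K j x)) ⟩
    ∑[ x < suc p ] ((c ≐ j) · p)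
      ≡⟨ ∑-const (suc p) _ ⟩
    suc p * ((c ≐ j) · p)
      ≡⟨ *-· (suc p) (c ≐ j) p ⟩
    (c ≐ j) · (suc p * p)
      ≡⟨ cong ((c ≐ j) ·_) (2*C₂[1+p]≡[1+p]*p p) ⟨
    (c ≐ j) · (2 * C₂ (suc p))
      ≡⟨ *-· 2 (c ≐ j) (C₂ (suc p)) ⟨
    2 * (c ↦ C₂ (suc p)) j
      ∎
    where open ≡-Reasoning

  clique : Uniform k (c ↦ p) (c ↦ C₂ (suc p))
  clique = record
    { graph         = K
    ; colourDegree≡ = colourDegree-K
    ; e≡            = λ j v → e≡-from-eOrdered K j v (eOrdered-K j v)
    }

-- Cartesian products

isColour : ∀ {k} → Fin k → Maybe (Fin k) → Bool
isColour j m = ⌊ ≡-dec _≟_ m (just j) ⌋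

is-just-if : ∀ {A : Set} b (m : Maybe A) → is-just (if b then m else nothing) ≡ b ∧ is-just m
is-just-if true  m = refl
is-just-if false m = refl

module _ {k A B : ℕ} (G : ColouredGraph A k) (H : ColouredGraph B k) where
  private
    module G = ColouredGraph G
    module H = ColouredGraph H

  □-edge : Fin A × Fin B → Fin A × Fin B → Maybe (Fin k)
  □-edge (u , w) (u′ , w′) = if u ≐ u′ then H.E w w′ else if w ≐ w′ then G.E u u′ else nothing

  _□_ : ColouredGraph (A * B) k
  _□_ = record
    { E        = λ x y → □-edge (remQuot B x) (remQuot B y)
    ; sym      = λ x y → □-edge-sym (remQuot B x) (remQuot B y)
    ; loopless = λ x → □-edge-loopless (remQuot B x)
    }
    where
    □-edge-sym : ∀ p q → □-edge p q ≡ □-edge q p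
    □-edge-sym (u , w) (u′ , w′) rewrite ≐-sym u u′ with u′ ≟ u
    ... | yes refl = H.sym w w′
    ... | no _ rewrite ≐-sym w w′ with w′ ≟ w
    ...   | yes refl = G.sym u u′
    ...   | no _     = refl
    □-edge-loopless : ∀ p → □-edge p p ≡ nothing
    □-edge-loopless (u , w) rewrite ≐-refl u = H.loopless w

  private
    P = _□_

  E-□ : ∀ u w u′ w′ → ColouredGraph.E P (combine u w) (combine u′ w′) ≡ □-edge (u , w) (u′ , w′)
  E-□ u w u′ w′ = cong₂ □-edge (remQuot-combine u w) (remQuot-combine u′ w′)

  𝟙-hasColour-□ : ∀ j u w u′ w′ →
    𝟙 (hasColour P j (combine u w) (combine u′ w′))
      ≡ (u ≐ u′) · 𝟙 (hasColour H j w w′) + (w ≐ w′) · 𝟙 (hasColour G j u u′)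
  𝟙-hasColour-□ j u w u′ w′ = trans (cong (𝟙 ∘ isColour j) (E-□ u w u′ w′)) (by-cases (u ≟ u′) (w ≟ w′))
    where
    by-cases : (u≟u′ : Dec (u ≡ u′)) (w≟w′ : Dec (w ≡ w′)) →
      𝟙 (isColour j (if ⌊ u≟u′ ⌋ then H.E w w′ else if ⌊ w≟w′ ⌋ then G.E u u′ else nothing))
        ≡ ⌊ u≟u′ ⌋ · 𝟙 (hasColour H j w w′) + ⌊ w≟w′ ⌋ · 𝟙 (hasColour G j u u′)
    by-cases (yes refl) w≟w′ rewrite hasColour-irrefl G j u | ·-zeroʳ ⌊ w≟w′ ⌋ = sym (+-identityʳ _)
    by-cases (no _)     (yes _) = refl
    by-cases (no _)     (no _)  = refl

  colourDegree-□ : ∀ j u w → colourDegree P j (combine u w) ≡ colourDegree G j u + colourDegree H j w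
  colourDegree-□ j u w = begin
    colourDegree P j (combine u w)
      ≡⟨ count≡∑𝟙 (hasColour P j (combine u w)) ⟩
    ∑[ y < A * B ] 𝟙 (hasColour P j (combine u w) y)
      ≡⟨ ∑-combine {A} {B} _ ⟩
    ∑[ u′ < A ] ∑[ w′ < B ] 𝟙 (hasColour P j (combine u w) (combine u′ w′))
      ≡⟨ sum-cong-≗ (λ u′ → sum-cong-≗ (𝟙-hasColour-□ j u w u′)) ⟩
    ∑[ u′ < A ] ∑[ w′ < B ] ((u ≐ u′) · hH w′ + (w ≐ w′) · hG u′)
      ≡⟨ sum-cong-≗ (λ u′ → ∑-distrib-+ (λ w′ → (u ≐ u′) · hH w′) (λ w′ → (w ≐ w′) · hG u′)) ⟩
    ∑[ u′ < A ] (∑[ w′ < B ] ((u ≐ u′) · hH w′) + ∑[ w′ < B ] ((w ≐ w′) · hG u′))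
      ≡⟨ sum-cong-≗ (λ u′ → cong₂ _+_ (∑-· (u ≐ u′) hH) (∑-δˡ w (λ _ → hG u′))) ⟩
    ∑[ u′ < A ] ((u ≐ u′) · sum hH + hG u′)
      ≡⟨ ∑-distrib-+ (λ u′ → (u ≐ u′) · sum hH) hG ⟩
    ∑[ u′ < A ] ((u ≐ u′) · sum hH) + sum hG
      ≡⟨ cong (_+ sum hG) (∑-δˡ u (λ _ → sum hH)) ⟩
    sum hH + sum hG
      ≡⟨ +-comm (sum hH) (sum hG) ⟩
    sum hG + sum hH
      ≡⟨ cong₂ _+_ (count≡∑𝟙 (hasColour G j u)) (count≡∑𝟙 (hasColour H j w)) ⟨
    colourDegree G j u + colourDegree H j w
      ∎
    where
    open ≡-Reasoning
    hG : Fin A → ℕ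
    hG u′ = 𝟙 (hasColour G j u u′)
    hH : Fin B → ℕ
    hH w′ = 𝟙 (hasColour H j w w′)

  inClosedNbhd-□ : ∀ u w u₁ w₁ →
    inClosedNbhd P (combine u w) (combine u₁ w₁) ≡ (u₁ ≐ u ∧ w₁ ≐ w) ∨ is-just (□-edge (u , w) (u₁ , w₁))
  inClosedNbhd-□ u w u₁ w₁ = cong₂ (λ b m → b ∨ is-just m) (combine-≐ u₁ w₁ u w) (E-□ u w u₁ w₁)

  inClosedNbhd-□-fibreᴴ : ∀ u w w₁ → inClosedNbhd P (combine u w) (combine u w₁) ≡ inClosedNbhd H w w₁
  inClosedNbhd-□-fibreᴴ u w w₁ rewrite inClosedNbhd-□ u w u w₁ | ≐-refl u = refl

  inClosedNbhd-□-fibreᴳ : ∀ u w u₁ → inClosedNbhd P (combine u w) (combine u₁ w) ≡ inClosedNbhd G u u₁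
  inClosedNbhd-□-fibreᴳ u w u₁ rewrite inClosedNbhd-□ u w u₁ w | ≐-refl w | H.loopless w with u₁ ≟ u
  ... | yes refl = refl
  ... | no u₁≢u rewrite ≐-false (u₁≢u ∘ sym) = refl

  inClosedNbhd-□-offᴴ : ∀ {u u₁} → u₁ ≢ u → ∀ w w₁ →
    inClosedNbhd P (combine u w) (combine u₁ w₁) ≡ (w₁ ≐ w ∧ is-just (G.E u u₁))
  inClosedNbhd-□-offᴴ {u} {u₁} u₁≢u w w₁
    rewrite inClosedNbhd-□ u w u₁ w₁ | ≐-false u₁≢u | ≐-false (u₁≢u ∘ sym) | ≐-sym w w₁ =
    is-just-if (w₁ ≐ w) (G.E u u₁)

  inClosedNbhd-□-offᴳ : ∀ {w w₁} → w₁ ≢ w → ∀ u u₁ →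
    inClosedNbhd P (combine u w) (combine u₁ w₁) ≡ (u₁ ≐ u ∧ inClosedNbhd H w w₁)
  inClosedNbhd-□-offᴳ {w} {w₁} w₁≢w u u₁ with u₁ ≟ u
  ... | yes refl = inClosedNbhd-□-fibreᴴ u w w₁
  ... | no u₁≢u rewrite inClosedNbhd-□-offᴴ u₁≢u w w₁ | ≐-false w₁≢w = refl

  -- An edge of the product inside N[(u , w)] lies in the fibre {u} × N_H[w] or in N_G[u] × {w}.
  module _ (j : Fin k) (u : Fin A) (w : Fin B) where
    private
      N : Fin A → Fin B → Bool
      N u₁ w₁ = inClosedNbhd P (combine u w) (combine u₁ w₁)
      termᴴ : Fin B → Fin B → ℕ
      termᴴ w₁ w₂ = 𝟙 (inClosedNbhd H w w₁ ∧ inClosedNbhd H w w₂ ∧ hasColour H j w₁ w₂)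
      termᴳ : Fin A → Fin A → ℕ
      termᴳ u₁ u₂ = 𝟙 (inClosedNbhd G u u₁ ∧ inClosedNbhd G u u₂ ∧ hasColour G j u₁ u₂)

    fibreᴴ : ∀ u₁ w₁ u₂ w₂ →
      N u₁ w₁ · N u₂ w₂ · (u₁ ≐ u₂) · 𝟙 (hasColour H j w₁ w₂) ≡ (u ≐ u₁) · (u ≐ u₂) · termᴴ w₁ w₂
    fibreᴴ u₁ w₁ u₂ w₂ with u₁ ≟ u₂
    ... | no u₁≢u₂ = trans (·-·-zeroʳ (N u₁ w₁) (N u₂ w₂)) (sym (·-≐-≢ {x = u} (termᴴ w₁ w₂) u₁≢u₂))
    ... | yes refl with u₁ ≟ u
    ...   | yes refl rewrite inClosedNbhd-□-fibreᴴ u w w₁ | inClosedNbhd-□-fibreᴴ u w w₂ | ≐-refl u =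
      sym (𝟙-∧ (inClosedNbhd H w w₁) (inClosedNbhd H w w₂) (hasColour H j w₁ w₂))
    ...   | no u₁≢u
      rewrite inClosedNbhd-□-offᴴ u₁≢u w w₁ | inClosedNbhd-□-offᴴ u₁≢u w w₂ | ≐-false (u₁≢u ∘ sym) =
      ·-·-𝟙-hasColour-≐ H j w w₁ w₂ _ _

    fibreᴳ : ∀ u₁ w₁ u₂ w₂ →
      N u₁ w₁ · N u₂ w₂ · (w₁ ≐ w₂) · 𝟙 (hasColour G j u₁ u₂) ≡ (w ≐ w₁) · (w ≐ w₂) · termᴳ u₁ u₂
    fibreᴳ u₁ w₁ u₂ w₂ with w₁ ≟ w₂
    ... | no w₁≢w₂ = trans (·-·-zeroʳ (N u₁ w₁) (N u₂ w₂)) (sym (·-≐-≢ {x = w} (termᴳ u₁ u₂) w₁≢w₂))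
    ... | yes refl with w₁ ≟ w
    ...   | yes refl rewrite inClosedNbhd-□-fibreᴳ u w u₁ | inClosedNbhd-□-fibreᴳ u w u₂ | ≐-refl w =
      sym (𝟙-∧ (inClosedNbhd G u u₁) (inClosedNbhd G u u₂) (hasColour G j u₁ u₂))
    ...   | no w₁≢w
      rewrite inClosedNbhd-□-offᴳ w₁≢w u u₁ | inClosedNbhd-□-offᴳ w₁≢w u u₂ | ≐-false (w₁≢w ∘ sym) =
      ·-·-𝟙-hasColour-≐ G j u u₁ u₂ _ _

    𝟙-eOrdered-□ : ∀ u₁ w₁ u₂ w₂ →
      𝟙 (N u₁ w₁ ∧ N u₂ w₂ ∧ hasColour P j (combine u₁ w₁) (combine u₂ w₂))
        ≡ (u ≐ u₁) · (u ≐ u₂) · termᴴ w₁ w₂ + (w ≐ w₁) · (w ≐ w₂) · termᴳ u₁ u₂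
    𝟙-eOrdered-□ u₁ w₁ u₂ w₂ = begin
      𝟙 (N₁ ∧ N₂ ∧ hasColour P j (combine u₁ w₁) (combine u₂ w₂))
        ≡⟨ 𝟙-∧ N₁ N₂ _ ⟩
      N₁ · N₂ · 𝟙 (hasColour P j (combine u₁ w₁) (combine u₂ w₂))
        ≡⟨ cong (λ x → N₁ · N₂ · x) (𝟙-hasColour-□ j u₁ w₁ u₂ w₂) ⟩
      N₁ · N₂ · ((u₁ ≐ u₂) · 𝟙 (hasColour H j w₁ w₂) + (w₁ ≐ w₂) · 𝟙 (hasColour G j u₁ u₂))
        ≡⟨ ·-·-distribˡ-+ N₁ N₂ _ _ ⟩
      N₁ · N₂ · (u₁ ≐ u₂) · 𝟙 (hasColour H j w₁ w₂) + N₁ · N₂ · (w₁ ≐ w₂) · 𝟙 (hasColour G j u₁ u₂)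
        ≡⟨ cong₂ _+_ (fibreᴴ u₁ w₁ u₂ w₂) (fibreᴳ u₁ w₁ u₂ w₂) ⟩
      (u ≐ u₁) · (u ≐ u₂) · termᴴ w₁ w₂ + (w ≐ w₁) · (w ≐ w₂) · termᴳ u₁ u₂
        ∎
      where
      open ≡-Reasoning
      N₁ = N u₁ w₁
      N₂ = N u₂ w₂

    eOrdered-□ : eOrdered P j (combine u w) ≡ eOrdered G j u + eOrdered H j w
    eOrdered-□ = begin
      eOrdered P j (combine u w)
        ≡⟨ ∑-combine {A} {B} (λ x → sum (F x)) ⟩
      ∑[ u₁ < A ] ∑[ w₁ < B ] ∑[ y < A * B ] F (combine u₁ w₁) y
        ≡⟨ sum-cong-≗ {A} (λ u₁ → sum-cong-≗ {B} λ w₁ → ∑-combine {A} {B} (F (combine u₁ w₁))) ⟩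
      ∑[ u₁ < A ] ∑[ w₁ < B ] ∑[ u₂ < A ] ∑[ w₂ < B ] F (combine u₁ w₁) (combine u₂ w₂)
        ≡⟨ sum-cong-≗ (λ u₁ → sum-cong-≗ λ w₁ → sum-cong-≗ λ u₂ → sum-cong-≗ (𝟙-eOrdered-□ u₁ w₁ u₂)) ⟩
      ∑[ u₁ < A ] ∑[ w₁ < B ] ∑[ u₂ < A ] ∑[ w₂ < B ] (Tᴴ u₁ w₁ u₂ w₂ + Tᴳ u₁ w₁ u₂ w₂)
        ≡⟨ ∑⁴-distrib-+ {A} {B} Tᴴ Tᴳ ⟩
      ∑[ u₁ < A ] ∑[ w₁ < B ] ∑[ u₂ < A ] ∑[ w₂ < B ] Tᴴ u₁ w₁ u₂ w₂
        + ∑[ u₁ < A ] ∑[ w₁ < B ] ∑[ u₂ < A ] ∑[ w₂ < B ] Tᴳ u₁ w₁ u₂ w₂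
        ≡⟨ cong₂ _+_ (∑⁴-fibreˡ {A} {B} u termᴴ) (∑⁴-fibreʳ {A} {B} w termᴳ) ⟩
      eOrdered H j w + eOrdered G j u
        ≡⟨ +-comm (eOrdered H j w) (eOrdered G j u) ⟩
      eOrdered G j u + eOrdered H j w
        ∎
      where
      open ≡-Reasoning
      F : Fin (A * B) → Fin (A * B) → ℕ
      F x y = 𝟙 (inClosedNbhd P (combine u w) x ∧ inClosedNbhd P (combine u w) y ∧ hasColour P j x y)
      Tᴴ Tᴳ : Fin A → Fin B → Fin A → Fin B → ℕ
      Tᴴ u₁ w₁ u₂ w₂ = (u ≐ u₁) · (u ≐ u₂) · termᴴ w₁ w₂
      Tᴳ u₁ w₁ u₂ w₂ = (w ≐ w₁) · (w ≐ w₂) · termᴳ u₁ u₂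

∀-combine : ∀ {m n} {Q : Fin (m * n) → Set} → (∀ u w → Q (combine u w)) → ∀ x → Q x
∀-combine {m} {n} {Q} h x = subst Q (combine-remQuot {m} n x) (h (proj₁ (remQuot {m} n x)) (proj₂ (remQuot {m} n x)))

infixr 6 _⊠_
_⊠_ : ∀ {k} {d d′ ε ε′ : Fin k → ℕ} → Uniform k d ε → Uniform k d′ ε′ →
      Uniform k (λ j → d j + d′ j) (λ j → ε j + ε′ j)
_⊠_ {d = d} {d′} {ε} {ε′} U U′ = record
  { graph         = G □ H
  ; colourDegree≡ = λ j → ∀-combine λ u w →
      trans (colourDegree-□ G H j u w) (cong₂ _+_ (U.colourDegree≡ j u) (U′.colourDegree≡ j w))
  ; e≡            = λ j → ∀-combine λ u w →
      e≡-from-eOrdered (G □ H) j (combine u w) (begin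
        eOrdered (G □ H) j (combine u w)  ≡⟨ eOrdered-□ G H j u w ⟩
        eOrdered G j u + eOrdered H j w   ≡⟨ cong₂ _+_ (U.eOrdered≡ j u) (U′.eOrdered≡ j w) ⟩
        2 * ε j + 2 * ε′ j                ≡⟨ *-distribˡ-+ 2 (ε j) (ε′ j) ⟨
        2 * (ε j + ε′ j)                  ∎)
  }
  where
  open ≡-Reasoning
  module U = Uniform U
  module U′ = Uniform U′
  G = U.graph
  H = U′.graph

⨂ : ∀ {k m} {d ε : Fin m → Fin k → ℕ} → (∀ i → Uniform k (d i) (ε i)) →
  Uniform k (λ j → ∑[ i < m ] d i j) (λ j → ∑[ i < m ] ε i j)
⨂ {m = zero}  U = point
⨂ {m = suc m} U = U zero ⊠ ⨂ (U ∘ suc)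

-- Partitions

-- A part p stands for a clique on p + 1 vertices.
record Partition (a t : ℕ) : Set where
  field
    parts    : List ℕ
    ∑parts   : List.sum parts ≡ a
    ∑C₂parts : List.sum (map C₂ parts) ≡ t

infixr 6 _⊕_
_⊕_ : ∀ {a t a′ t′} → Partition a t → Partition a′ t′ → Partition (a + a′) (t + t′)
P ⊕ P′ = record
  { parts    = P.parts ++ P′.parts
  ; ∑parts   = trans (sum-++ P.parts P′.parts) (cong₂ _+_ P.∑parts P′.∑parts)
  ; ∑C₂parts = trans (cong List.sum (map-++ C₂ P.parts P′.parts))
                 (trans (sum-++ (map C₂ P.parts) (map C₂ P′.parts)) (cong₂ _+_ P.∑C₂parts P′.∑C₂parts))
  }
  where
  module P = Partition P
  module P′ = Partition P′

empty : Partition 0 0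
empty = record { parts = [] ; ∑parts = refl ; ∑C₂parts = refl }

singleton : ∀ p → Partition p (C₂ p)
singleton p = record { parts = p ∷ [] ; ∑parts = +-identityʳ p ; ∑C₂parts = +-identityʳ (C₂ p) }

ones : ∀ a → Partition a 0
ones zero    = empty
ones (suc a) = singleton 1 ⊕ ones a

twos : ∀ r → Partition (2 * r) r
twos zero    = empty
twos (suc r) = subst (λ a → Partition a (suc r)) (sym (*-suc 2 r)) (singleton 2 ⊕ twos r)

Partition-≤ : ∀ {a b t} → Partition a t → a ≤ b → Partition b t
Partition-≤ {a} {b} {t} P a≤b = subst₂ Partition (m+[n∸m]≡n a≤b) (+-identityʳ t) (P ⊕ ones (b ∸ a))

∑C₂∘suc : ∀ ps → List.sum (map (C₂ ∘ suc) ps) ≡ List.sum ps + List.sum (map C₂ ps)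
∑C₂∘suc []       = refl
∑C₂∘suc (p ∷ ps) rewrite ∑C₂∘suc ps = +-interchange p (C₂ p) (List.sum ps) (List.sum (map C₂ ps))

cliques : ∀ {k} (c : Fin k) (ps : List ℕ) → Uniform k (c ↦ List.sum ps) (c ↦ List.sum (map (C₂ ∘ suc) ps))
cliques c []       = Uniform-cong (λ j → sym (·-zeroʳ (c ≐ j))) (λ j → sym (·-zeroʳ (c ≐ j))) point
cliques c (p ∷ ps) =
  Uniform-cong (λ j → sym (·-distribˡ-+ (c ≐ j) p _)) (λ j → sym (·-distribˡ-+ (c ≐ j) (C₂ (suc p)) _))
    (clique c p ⊠ cliques c ps)

uniform-from-partition : ∀ {k a t} (c : Fin k) → Partition a t → Uniform k (c ↦ a) (c ↦ (a + t))
uniform-from-partition c P =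
  Uniform-cong (λ j → cong ((c ≐ j) ·_) ∑parts)
               (λ j → cong ((c ≐ j) ·_) (trans (∑C₂∘suc parts) (cong₂ _+_ ∑parts ∑C₂parts)))
    (cliques c parts)
  where open Partition P

uniform-from-partitions : ∀ {k} {a t : Fin k → ℕ} → (∀ j → Partition (a j) (t j)) → Uniform k a (λ j → a j + t j)
uniform-from-partitions {a = a} {t} P =
  Uniform-cong (λ j → ∑-δʳ j a) (λ j → ∑-δʳ j (λ i → a i + t i)) (⨂ (λ c → uniform-from-partition c (P c)))

isFlipSequence-from-partitions : ∀ {k} (a t : Fin k → ℕ) → (∀ i → 0 < a i) → (∀ i j → toℕ i < toℕ j → a i < a j) →
  (∀ j → Partition (a j) (t j)) → (∀ i j → toℕ i < toℕ j → a j + t j < a i + t i) → IsFlipSequence k a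
isFlipSequence-from-partitions a t a>0 a-increasing P a+t-decreasing =
  a>0 , a-increasing , n , graph , colourDegree≡ ,
  λ v i j i<j → subst₂ _<_ (sym (e≡ j v)) (sym (e≡ i v)) (a+t-decreasing i j i<j)
  where open Uniform (uniform-from-partitions P)

-- Arithmetic

C₂-+ : ∀ m n → C₂ (m + n) ≡ C₂ m + m * n + C₂ n
C₂-+ zero    n = refl
C₂-+ (suc m) n = trans (cong (m + n +_) (C₂-+ m n)) (rearrange m n (C₂ m) (C₂ n))
  where
  rearrange : ∀ m n x y → m + n + (x + m * n + y) ≡ m + x + (n + m * n) + y
  rearrange = solve-∀

C₂-divMod : ∀ t → ∃[ p ] ∃[ r ] r ≤ p × C₂ (suc p) + r ≡ t
C₂-divMod zero = 0 , 0 , z≤n , refl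
C₂-divMod (suc t) with C₂-divMod t
... | p , r , r≤p , refl with m≤n⇒m<n∨m≡n r≤p
...   | inj₁ r<p  = p , suc r , r<p , +-suc (C₂ (suc p)) r
...   | inj₂ refl = suc r , 0 , z≤n , trans (+-identityʳ _) (cong suc (+-comm r (C₂ (suc r))))

Steep : (ℕ → ℕ) → Set
Steep g = ∀ s δ → suc s + g δ < g (suc s + δ)

2*-steep : Steep (2 *_)
2*-steep s δ = subst (suc s + 2 * δ <_) (rearrange s δ) (m<n+m (suc s + 2 * δ) z<s)
  where
  rearrange : ∀ s δ → suc s + (suc s + 2 * δ) ≡ 2 * (suc s + δ)
  rearrange = solve-∀

C₂[2+]-steep : Steep (λ δ → C₂ (2 + δ))
C₂[2+]-steep s δ = begin-strict
  suc s + C₂ (2 + δ)                         <⟨ +-monoˡ-< (C₂ (2 + δ)) (m<m*n (suc s) (2 + δ) (s≤s (s≤s z≤n))) ⟩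
  suc s * (2 + δ) + C₂ (2 + δ)               ≤⟨ +-monoˡ-≤ (C₂ (2 + δ)) (m≤n+m (suc s * (2 + δ)) (C₂ (suc s))) ⟩
  C₂ (suc s) + suc s * (2 + δ) + C₂ (2 + δ)  ≡⟨ C₂-+ (suc s) (2 + δ) ⟨
  C₂ (suc s + (2 + δ))                       ≡⟨ cong C₂ (+-suc (suc s) (suc δ)) ⟩
  C₂ (suc (suc s + suc δ))                   ≡⟨ cong (C₂ ∘′ suc) (+-suc (suc s) δ) ⟩
  C₂ (2 + (suc s + δ))                       ∎
  where open ≤-Reasoning

decreasing-from-steep : ∀ {g} → Steep g → ∀ {x y c} → x < y → y ≤ c → y + g (c ∸ y) < x + g (c ∸ x)
decreasing-from-steep {g} steep {x} x<y y≤c with m≤n⇒∃[o]m+o≡n x<y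
... | s , refl with m≤n⇒∃[o]m+o≡n y≤c
...   | δ , refl = begin-strict
  suc x + s + g (suc x + s + δ ∸ (suc x + s))  ≡⟨ cong (λ z → suc x + s + g z) (m+n∸m≡n (suc x + s) δ) ⟩
  suc x + s + g δ                              ≡⟨ +-assoc (suc x) s (g δ) ⟩
  suc (x + (s + g δ))                          ≡⟨ +-suc x (s + g δ) ⟨
  x + (suc s + g δ)                            <⟨ +-monoʳ-< x (steep s δ) ⟩
  x + g (suc s + δ)                            ≡⟨ cong (λ z → x + g z) (m+n∸m≡n x (suc s + δ)) ⟨
  x + g (x + (suc s + δ) ∸ x)                  ≡⟨ cong (λ z → x + g (z ∸ x)) x+[1+s+δ]≡c ⟩
  x + g (suc x + s + δ ∸ x)                    ∎
  where
  open ≤-Reasoning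
  x+[1+s+δ]≡c : x + (suc s + δ) ≡ suc x + s + δ
  x+[1+s+δ]≡c = trans (+-suc x (s + δ)) (cong suc (sym (+-assoc x s δ)))

2+[c∸a]≤a : ∀ {a c} → 2 ≤ a → c ≤ 2 * a ∸ 2 → 2 + (c ∸ a) ≤ a
2+[c∸a]≤a {suc (suc b)} {c} (s≤s (s≤s _)) c≤2a∸2 =
  s≤s (s≤s (≤-trans (∸-monoˡ-≤ (2 + b) c≤2a∸2) (≤-reflexive b+[2+b]∸[2+b]≡b)))
  where
  b+[2+b]∸[2+b]≡b : b + (2 + (b + 0)) ∸ (2 + b) ≡ b
  b+[2+b]∸[2+b]≡b = trans (cong (λ z → b + (2 + z) ∸ (2 + b)) (+-identityʳ b)) (m+n∸n≡m b (2 + b))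

m*m<n*n⇒m<n : ∀ {m n} → m * m < n * n → m < n
m*m<n*n⇒m<n m*m<n*n = ≰⇒> (λ n≤m → <⇒≱ m*m<n*n (*-mono-≤ n≤m n≤m))

[1+p]*p≤m*m⇒p<m : ∀ {p m} → 1 ≤ m → suc p * p ≤ m * m → p < m
[1+p]*p≤m*m⇒p<m {p} {m} 1≤m h = ≰⇒> λ m≤p → <⇒≱ (m*m<[1+p]*p m≤p) h
  where
  m*m<[1+p]*p : m ≤ p → m * m < suc p * p
  m*m<[1+p]*p m≤p = ≤-<-trans (*-monoʳ-≤ m m≤p) (*-monoˡ-< p {{>-nonZero (≤-trans 1≤m m≤p)}} (s≤s m≤p))

-- With a = p + 1 + X, the floor condition forces 100 a ≤ (2X + 1)², while
-- a ≥ p + 1 ≥ 1 + q(q+1)/2 makes 100 a exceed (6q + 1)².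
surplus-large : ∀ p q X W → suc p * p + W ≤ (suc p + X) * (suc p + X) →
  100 * ((suc p + X) * ((suc p + X) * (suc p + X))) ≤ W * W → suc q * q ≤ 2 * p → 3 * q < X
surplus-large p q X W hW floor q-small =
  *-cancelˡ-< 2 (3 * q) X (+-cancelʳ-< 1 (2 * (3 * q)) (2 * X) (m*m<n*n⇒m<n (<-≤-trans [6q+1]²<100a 100a≤[2X+1]²)))
  where
  a = suc p + X
  W≤a[2X+1] : W ≤ a * (2 * X + 1)
  W≤a[2X+1] = +-cancelˡ-≤ (suc p * p) W _ (≤-trans hW (≤-trans (m≤m+n (a * a) (X + X * X)) (≤-reflexive (expand p X))))
    where
    expand : ∀ p X → (suc p + X) * (suc p + X) + (X + X * X) ≡ suc p * p + (suc p + X) * (2 * X + 1)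
    expand = solve-∀
  100a≤[2X+1]² : 100 * a ≤ (2 * X + 1) * (2 * X + 1)
  100a≤[2X+1]² = *-cancelˡ-≤ (a * a)
    (subst₂ _≤_ (factor₁ a) (factor₂ a (2 * X + 1)) (≤-trans floor (*-mono-≤ W≤a[2X+1] W≤a[2X+1])))
    where
    factor₁ : ∀ a → 100 * (a * (a * a)) ≡ a * a * (100 * a)
    factor₁ = solve-∀
    factor₂ : ∀ a b → a * b * (a * b) ≡ a * a * (b * b)
    factor₂ = solve-∀
  [6q+1]²<100a : (2 * (3 * q) + 1) * (2 * (3 * q) + 1) < 100 * a
  [6q+1]²<100a = begin-strict
    (2 * (3 * q) + 1) * (2 * (3 * q) + 1)                                 <⟨ m<m+n _ z<s ⟩
    (2 * (3 * q) + 1) * (2 * (3 * q) + 1) + (99 + (14 * (q * q) + 38 * q)) ≡⟨ complete q ⟩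
    100 + 50 * (suc q * q)                                                ≤⟨ +-monoʳ-≤ 100 (*-monoʳ-≤ 50 q-small) ⟩
    100 + 50 * (2 * p)                                                    ≤⟨ m≤m+n _ (100 * X) ⟩
    100 + 50 * (2 * p) + 100 * X                                          ≡⟨ regroup p X ⟩
    100 * a                                                               ∎
    where
    open ≤-Reasoning
    complete : ∀ q → (2 * (3 * q) + 1) * (2 * (3 * q) + 1) + (99 + (14 * (q * q) + 38 * q)) ≡ 100 + 50 * (suc q * q)
    complete = solve-∀
    regroup : ∀ p X → 100 + 50 * (2 * p) + 100 * X ≡ 100 * (suc p + X)
    regroup = solve-∀

floorCondition-cost : ∀ {a d p q r} → 1 ≤ a → 4 * d ≤ a ^ 2 → 100 * a ^ 3 ≤ (a ^ 2 ∸ 4 * d) ^ 2 →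
  suc p * p ≤ 4 * d → suc q * q ≤ 2 * p → r ≤ q → suc p + (suc q + 2 * r) ≤ a
floorCondition-cost {a} {d} {p} {q} {r} 1≤a 4d≤a² floor p-small q-small r≤q = begin
  suc p + (suc q + 2 * r)  ≤⟨ +-monoʳ-≤ (suc p) (+-monoʳ-≤ (suc q) (*-monoʳ-≤ 2 r≤q)) ⟩
  suc p + (suc q + 2 * q)  ≡⟨⟩
  suc p + suc (3 * q)      ≤⟨ +-monoʳ-≤ (suc p) 3q<X ⟩
  suc p + X                ≡⟨ a≡1+p+X ⟨
  a                        ∎
  where
  open ≤-Reasoning
  W = a ^ 2 ∸ 4 * d
  hW : suc p * p + W ≤ a * a
  hW = ≤-trans (+-monoˡ-≤ W p-small) (≤-reflexive (trans (m+[n∸m]≡n 4d≤a²) (cong (a *_) (*-identityʳ a))))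
  p<a : p < a
  p<a = [1+p]*p≤m*m⇒p<m 1≤a (≤-trans (m≤m+n _ W) hW)
  X = a ∸ suc p
  a≡1+p+X : a ≡ suc p + X
  a≡1+p+X = sym (m+[n∸m]≡n p<a)
  floor′ : 100 * (a * (a * a)) ≤ W * W
  floor′ = subst₂ (λ x y → 100 * x ≤ y) (cong (λ z → a * (a * z)) (*-identityʳ a)) (cong (W *_) (*-identityʳ W)) floor
  3q<X : 3 * q < X
  3q<X = surplus-large p q X W (subst (λ b → suc p * p + W ≤ b * b) a≡1+p+X hW)
                               (subst (λ b → 100 * (b * (b * b)) ≤ W * W) a≡1+p+X floor′) q-small

floorCondition-partition : ∀ {a d t} → 1 ≤ a → 4 * d ≤ a ^ 2 → 100 * a ^ 3 ≤ (a ^ 2 ∸ 4 * d) ^ 2 →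
  t ≤ 2 * d → Partition a t
floorCondition-partition {a} {d} {t} 1≤a 4d≤a² floor t≤2d with C₂-divMod t
... | p , r₁ , r₁≤p , refl with C₂-divMod r₁
...   | q , r , r≤q , refl =
  Partition-≤ (singleton (suc p) ⊕ singleton (suc q) ⊕ twos r)
              (floorCondition-cost {a} {d} 1≤a 4d≤a² floor p-small q-small r≤q)
  where
  open ≤-Reasoning
  p-small : suc p * p ≤ 4 * d
  p-small = begin
    suc p * p       ≡⟨ 2*C₂[1+p]≡[1+p]*p p ⟨
    2 * C₂ (suc p)  ≤⟨ *-monoʳ-≤ 2 (≤-trans (m≤m+n (C₂ (suc p)) (C₂ (suc q) + r)) t≤2d) ⟩
    2 * (2 * d)     ≡⟨ *-assoc 2 2 d ⟨
    4 * d           ∎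
  q-small : suc q * q ≤ 2 * p
  q-small = begin
    suc q * q       ≡⟨ 2*C₂[1+p]≡[1+p]*p q ⟨
    2 * C₂ (suc q)  ≤⟨ *-monoʳ-≤ 2 (≤-trans (m≤m+n _ r) r₁≤p) ⟩
    2 * p           ∎

module _ {m} {a : Fin (suc m) → ℕ} (increasing : ∀ i j → toℕ i < toℕ j → a i < a j) where

  head≤ : ∀ j → a zero ≤ a j
  head≤ zero    = ≤-refl
  head≤ (suc j) = <⇒≤ (increasing zero (suc j) z<s)

  ≤last : ∀ j → a j ≤ a (fromℕ m)
  ≤last j with m≤n⇒m<n∨m≡n (≤fromℕ j)
  ... | inj₁ j<m = <⇒≤ (increasing j (fromℕ m) j<m)
  ... | inj₂ j≡m = ≤-reflexive (cong a (toℕ-injective j≡m))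

  isFlipSequence-from-steep : (g : ℕ → ℕ) → Steep g → 0 < a zero →
    (∀ j → Partition (a j) (g (a (fromℕ m) ∸ a j))) → IsFlipSequence (suc m) a
  isFlipSequence-from-steep g steep a₁>0 P =
    isFlipSequence-from-partitions a (λ j → g (a (fromℕ m) ∸ a j)) (λ i → <-≤-trans a₁>0 (head≤ i)) increasing P
      (λ i j i<j → decreasing-from-steep steep (increasing i j i<j) (≤last j))

corollary5p3 : (m : ℕ) → 1 ≤ m → (a : Fin (suc m) → ℕ) →
    (∀ i j → toℕ i < toℕ j → a i < a j) → 3 ≤ a zero →
    (a (fromℕ m) ≤ 2 * a zero ∸ 2 ⊎ FloorCondition (a zero) (a (fromℕ m))) →
    IsFlipSequence (suc m) a
corollary5p3 m _ a increasing 3≤a₁ (inj₁ aₖ≤2a₁∸2) =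
  isFlipSequence-from-steep increasing (λ δ → C₂ (2 + δ)) C₂[2+]-steep (≤-trans (s≤s z≤n) 3≤a₁) λ j →
    Partition-≤ (singleton _)
      (2+[c∸a]≤a (≤-trans (n≤1+n 2) (≤-trans 3≤a₁ (head≤ increasing j)))
                 (≤-trans aₖ≤2a₁∸2 (∸-monoˡ-≤ 2 (*-monoʳ-≤ 2 (head≤ increasing j)))))
corollary5p3 m _ a increasing 3≤a₁ (inj₂ (4d≤a₁² , floor)) =
  isFlipSequence-from-steep increasing (2 *_) 2*-steep (≤-trans (s≤s z≤n) 3≤a₁) λ j →
    Partition-≤ (floorCondition-partition {d = a (fromℕ m) ∸ a zero} (≤-trans (s≤s z≤n) 3≤a₁) 4d≤a₁² floor
                   (*-monoʳ-≤ 2 (∸-monoʳ-≤ (a (fromℕ m)) (head≤ increasing j))))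
                (head≤ increasing j)
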